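{- Let $n\ge 1$ and $1\le t\le n$, and let $G$ be the disjoint union of $t$ copies of the complete graph $K_n$. Then $TTr(G)=t$.
   Context: All graphs are finite and simple. For disjoint vertex sets $A,B$, $A$ dominates $B$ if every vertex of $B$ has a neighbour in $A$. A tournament transitive partition of order $k$ of $G=(V,E)$ is a partition $\{V_1,\dots,V_k\}$ of $V$ into nonempty sets such that for all $1\le i<j\le k$, $V_i$ dominates $V_j$ and $V_j$ does not dominate $V_i$. The tournament transitivity $TTr(G)$ is the maximum $k$ for which such a partition exists. -}

module Defs where

open import Data.Nat using (ℕ; _≤_)
open import Data.Fin using (Fin; _<_)
open import Data.Product using (Σ; ∃; _×_; _,_)
open import Relation.Binary.PropositionalEquality using (_≡_; _≢_)
open import Relation.Nullary using (¬_)

record Graph (V : Set) : Set₁ where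
  field
    Adj     : V → V → Set
    sym     : ∀ {x y} → Adj x y → Adj y x
    irrefl  : ∀ {x} → ¬ Adj x x
open Graph public

-- A partition of V into k (labelled, ordered) parts V_0,…,V_{k-1},
-- given by the part-assignment p; every part is nonempty (p surjective).
Dominates : ∀ {V} (G : Graph V) {k} (p : V → Fin k) (i j : Fin k) → Set
Dominates G p i j = ∀ y → p y ≡ j → Σ _ λ x → p x ≡ i × Adj G x y

record IsTTPartition {V} (G : Graph V) (k : ℕ) (p : V → Fin k) : Set where
  field
    nonempty : ∀ i → Σ V λ x → p x ≡ i
    forward  : ∀ i j → i < j → Dominates G p i j
    backward : ∀ i j → i < j → ¬ Dominates G p j i

TTrIs : ∀ {V} (G : Graph V) (m : ℕ) → Set
TTrIs {V} G m =
  (Σ (V → Fin m) λ p → IsTTPartition G m p) ×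
  (∀ k (p : V → Fin k) → IsTTPartition G k p → k ≤ m)

-- Disjoint union of t copies of K_n: vertices (a , i), copy a, index i;
-- adjacent iff same copy and distinct indices.
tK : (t n : ℕ) → Graph (Fin t × Fin n)
tK t n = record
  { Adj    = λ { (a , i) (b , j) → a ≡ b × i ≢ j }
  ; sym    = λ { (e , ne) → Relation.Binary.PropositionalEquality.sym e , λ q → ne (Relation.Binary.PropositionalEquality.sym q) }
  ; irrefl = λ { (_ , ne) → ne Relation.Binary.PropositionalEquality.refl }
  }

-- Lower bound: put vertex (a , x) into part min(a, x). Copy a meets parts 0, …, a − 1 once each
-- and part a everywhere else, so each part i dominates every later part j, while part j cannot
-- dominate part i at the vertex (i , i), whose whole copy lies in parts ≤ i.
--
-- Upper bound: in a tournament transitive partition of a disjoint union of cliques, part i + 1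
-- fails to dominate part i at some vertex v. Then v has no neighbour in any part j > i either: part
-- i + 1 dominates part j, and a neighbour in part i + 1 of that vertex would lie in the clique of v.
-- So the clique of v has maximum part i; distinct parts thus give distinct cliques, and there are
-- at most t parts.
module Submission where

open import Defs hiding (sym)
open import Data.Nat as ℕ using (ℕ; _⊓_)
import Data.Nat.Properties as ℕ
open import Data.Fin using (Fin; toℕ; fromℕ<; inject≤; _≟_; _≤_; _<_)
open import Data.Fin.Properties
  using (toℕ<n; toℕ-fromℕ<; toℕ-inject≤; toℕ-injective; <-cmp; <⇒≢; any?; pigeonhole)
open import Data.Product using (∃; _×_; _,_; proj₁)
open import Data.Empty using (⊥-elim)
open import Relation.Binary.Definitions using (Decidable; tri<; tri≈; tri>)
open import Relation.Nullary using (¬_; Dec; yes; no)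
open import Relation.Nullary.Decidable using (_×-dec_; ¬?; map′; decidable-stable)
open import Relation.Binary.PropositionalEquality
  using (_≡_; _≢_; refl; sym; trans; cong; cong₂; subst; module ≡-Reasoning)

module _ {t n : ℕ} (t≤n : t ℕ.≤ n) where

  minPart : Fin t × Fin n → Fin t
  minPart (a , x) = fromℕ< (ℕ.m<n⇒m⊓o<n (toℕ x) (toℕ<n a))

  toℕ-minPart : ∀ a x → toℕ (minPart (a , x)) ≡ toℕ a ⊓ toℕ x
  toℕ-minPart a x = toℕ-fromℕ< (ℕ.m<n⇒m⊓o<n (toℕ x) (toℕ<n a))

  minPart≤copy : ∀ a x → minPart (a , x) ≤ a
  minPart≤copy a x = subst (ℕ._≤ toℕ a) (sym (toℕ-minPart a x)) (ℕ.m⊓n≤m (toℕ a) (toℕ x))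

  minPart≤index : ∀ a x → minPart (a , x) ≤ x
  minPart≤index a x = subst (ℕ._≤ toℕ x) (sym (toℕ-minPart a x)) (ℕ.m⊓n≤n (toℕ a) (toℕ x))

  diagonal : Fin t → Fin n
  diagonal i = inject≤ i t≤n

  minPart-diagonal : ∀ {i b} → i ≤ b → minPart (b , diagonal i) ≡ i
  minPart-diagonal {i} {b} i≤b = toℕ-injective (begin
    toℕ (minPart (b , diagonal i)) ≡⟨ toℕ-minPart b (diagonal i) ⟩
    toℕ b ⊓ toℕ (diagonal i)       ≡⟨ cong (toℕ b ⊓_) (toℕ-inject≤ i t≤n) ⟩
    toℕ b ⊓ toℕ i                  ≡⟨ ℕ.m≥n⇒m⊓n≡n i≤b ⟩
    toℕ i                          ∎)
    where open ≡-Reasoning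

  minPart-isTTPartition : IsTTPartition (tK t n) t minPart
  minPart-isTTPartition = record
    { nonempty = λ i → (i , diagonal i) , minPart-diagonal ℕ.≤-refl
    ; forward  = forward
    ; backward = backward
    }
    where
    forward : ∀ i j → i < j → Dominates (tK t n) minPart i j
    forward i _ i<j (b , x) refl =
      (b , diagonal i) , minPart-diagonal (ℕ.<⇒≤ (ℕ.<-≤-trans i<j (minPart≤copy b x))) ,
      refl , diagonal-i≢x
      where
      diagonal-i≢x : diagonal i ≢ x
      diagonal-i≢x eq = ℕ.<⇒≢ (ℕ.<-≤-trans i<j (minPart≤index b x))
                              (trans (sym (toℕ-inject≤ i t≤n)) (cong toℕ eq))

    backward : ∀ i j → i < j → ¬ Dominates (tK t n) minPart j i
    backward i j i<j dominates =
      let (b , x) , part-j , b≡i , _ = dominates (i , diagonal i) (minPart-diagonal ℕ.≤-refl)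
      in ℕ.<⇒≱ i<j (subst (_≤ i) part-j
                      (subst (λ c → minPart (c , x) ≤ i) (sym b≡i) (minPart≤copy i x)))

IsClusterGraph : ∀ {V} → Graph V → Set
IsClusterGraph G = ∀ {u w v} → Adj G u w → Adj G w v → u ≢ v → Adj G u v

tK-isClusterGraph : ∀ {t n} → IsClusterGraph (tK t n)
tK-isClusterGraph (refl , _) (refl , _) u≢v = refl , λ x≡z → u≢v (cong (_ ,_) x≡z)

module _ {V} {G : Graph V} (cluster : IsClusterGraph G)
         {k} {p : V → Fin k} (P : IsTTPartition G k p) where
  open IsTTPartition P

  neighbours-below : ∀ {j v} → p v ≢ j → (∀ u → p u ≡ j → ¬ Adj G u v) →
                     ∀ {w} → Adj G w v → p w < j
  neighbours-below {j} pv≢j no-neighbour {w} w~v with <-cmp (p w) j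
  ... | tri< pw<j _ _ = pw<j
  ... | tri≈ _ pw≡j _ = ⊥-elim (no-neighbour w pw≡j w~v)
  ... | tri> _ _ j<pw =
    let u , pu≡j , u~w = forward j (p w) j<pw w refl
    in ⊥-elim (no-neighbour u pu≡j (cluster u~w w~v λ { refl → pv≢j pu≡j }))

module _ {t n : ℕ} where

  tK-adj? : Decidable (Adj (tK t n))
  tK-adj? (a , x) (b , y) = (a ≟ b) ×-dec ¬? (x ≟ y)

  anyVertex? : {P : Fin t × Fin n → Set} → (∀ v → Dec (P v)) → Dec (∃ P)
  anyVertex? P? = map′ (λ (a , x , h) → (a , x) , h) (λ ((a , x) , h) → a , x , h)
                       (any? λ a → any? λ x → P? (a , x))

module _ {t n : ℕ} (G : Graph (Fin t × Fin n)) (adj? : Decidable (Adj G))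
         {k} (p : Fin t × Fin n → Fin k) where

  dominatedBy? : ∀ j v → Dec (∃ λ u → p u ≡ j × Adj G u v)
  dominatedBy? j v = anyVertex? (λ u → (p u ≟ j) ×-dec adj? u v)

  undominated : ∀ {i j} → ¬ Dominates G p j i → ∃ λ v → p v ≡ i × ∀ u → p u ≡ j → ¬ Adj G u v
  undominated {i} {j} ¬dominates with anyVertex? (λ v → (p v ≟ i) ×-dec ¬? (dominatedBy? j v))
  ... | yes (v , pv≡i , ¬dominated) = v , pv≡i , λ u pu≡j u~v → ¬dominated (u , pu≡j , u~v)
  ... | no ∄v = ⊥-elim (¬dominates λ v pv≡i →
                  decidable-stable (dominatedBy? j v) λ ¬dominated → ∄v (v , pv≡i , ¬dominated))

module _ {t n k} {p : Fin t × Fin n → Fin k} (P : IsTTPartition (tK t n) k p) where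
  open IsTTPartition P

  peak : ∀ i → ∃ λ v → p v ≡ i × ∀ {w} → Adj (tK t n) w v → p w ≤ i
  peak i with ℕ.suc (toℕ i) ℕ.<? k
  ... | no i-last =
    let v , pv≡i = nonempty i
    in v , pv≡i , λ {w} _ → ℕ.s≤s⁻¹ (ℕ.≤-trans (toℕ<n (p w)) (ℕ.≮⇒≥ i-last))
  ... | yes i+1<k =
    let v , pv≡i , no-neighbour = undominated (tK t n) tK-adj? p (backward i j i<j)
    in v , pv≡i , λ {w} w~v → ℕ.s≤s⁻¹ (subst (ℕ.suc (toℕ (p w)) ℕ.≤_) toℕ-j
         (neighbours-below tK-isClusterGraph P (λ pv≡j → <⇒≢ i<j (trans (sym pv≡i) pv≡j))
                           no-neighbour w~v))
    where
    j = fromℕ< i+1<k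
    toℕ-j : toℕ j ≡ ℕ.suc (toℕ i)
    toℕ-j = toℕ-fromℕ< i+1<k
    i<j : i < j
    i<j = subst (toℕ i ℕ.<_) (sym toℕ-j) ℕ.≤-refl

  peakCopy : Fin k → Fin t
  peakCopy i = proj₁ (proj₁ (peak i))

  peakCopy-<⇒≢ : ∀ {i j} → i < j → peakCopy i ≢ peakCopy j
  peakCopy-<⇒≢ {i} {j} i<j same =
    let (a , x) , pv≡i , below = peak i
        (b , y) , pw≡j , _     = peak j
        y≢x : y ≢ x
        y≢x y≡x = <⇒≢ i<j (trans (sym pv≡i) (trans (cong p (cong₂ _,_ same (sym y≡x))) pw≡j))
    in ℕ.<⇒≱ i<j (subst (_≤ i) pw≡j (below (sym same , y≢x)))

  parts≤copies : k ℕ.≤ t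
  parts≤copies = ℕ.≮⇒≥ λ t<k →
    let _ , _ , i<j , same = pigeonhole t<k peakCopy in peakCopy-<⇒≢ i<j same

lemma1 : (n t : ℕ) → 1 ℕ.≤ n → 1 ℕ.≤ t → t ℕ.≤ n → TTrIs (tK t n) t
lemma1 n t _ _ t≤n = (minPart t≤n , minPart-isTTPartition t≤n) , λ _ _ → parts≤copies
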